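{- Let $\{s(n)\}_{n\ge 0}$ be Stern's sequence, $\{t(n)\}_{n\ge0}$ the twisted Stern sequence, and $S(z)=\sum_{n\ge0}s(n)z^n$. (i) The series $$G(z):=\frac{\sum_{n\geq 0}(s(2+n)-s(1+n))z^n}{S(z)}$$ satisfies $$\sum_{n\geq 0}(s(2^{e+1}+n)-s(2^e+n))z^n=G(z^{2^e})S(z)$$ for all $e\in\mathbb{N}$. (ii) The series $$H(z):=-\frac{\sum_{n\geq 0}(t(2+n)+t(1+n))z^n}{S(z)}$$ satisfies $$(-1)^{e+1}\sum_{n\geq 0}(t(2^{e+1}+n)+t(2^e+n))z^n=H(z^{2^e})S(z)$$ for all $e\in\mathbb{N}$.
   Context: Stern's sequence is defined by $s(0)=0$, $s(1)=1$, and for $n\ge1$, $s(2n)=s(n)$, $s(2n+1)=s(n)+s(n+1)$. The twisted Stern sequence is defined by $t(0)=0$, $t(1)=1$, and for $n\ge1$, $t(2n)=-t(n)$, $t(2n+1)=-t(n)-t(n+1)$. All series are formal (Laurent) power series in $z$. -}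

module Defs where

open import Data.Nat as ℕ using (ℕ; zero; suc; ⌊_/2⌋)
open import Data.Nat.Divisibility using (_∣_; _∣?_)
open import Data.Integer as ℤ using (ℤ; +_; -[1+_])
open import Data.Bool using (Bool; true; false; if_then_else_)
open import Data.List using (List; []; _∷_)
open import Relation.Nullary using (yes; no)
open import Relation.Binary.PropositionalEquality using (_≡_)

-- Defined by fuel-bounded recursion on n via n = 2m or n = 2m+1.
-- With fuel f > n the recursion never runs out (the halves are smaller),
-- so s n = sF (suc n) n is exactly Stern's sequence.

isEven : ℕ → Bool
isEven zero = true
isEven (suc zero) = false
isEven (suc (suc n)) = isEven n

sF : ℕ → ℕ → ℤ
sF zero _ = + 0
sF (suc f) zero = + 0
sF (suc f) (suc zero) = + 1
sF (suc f) (suc (suc n)) =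
  let h = suc ⌊ n /2⌋ in                    -- h = ⌊ (n+2)/2 ⌋
  if isEven n then sF f h                    -- s(2h) = s(h)
  else sF f h ℤ.+ sF f (suc h)               -- s(2h+1) = s(h) + s(h+1)

s : ℕ → ℤ
s n = sF (suc n) n

tF : ℕ → ℕ → ℤ
tF zero _ = + 0
tF (suc f) zero = + 0
tF (suc f) (suc zero) = + 1
tF (suc f) (suc (suc n)) =
  let h = suc ⌊ n /2⌋ in
  if isEven n then ℤ.- tF f h                -- t(2h) = -t(h)
  else ℤ.- tF f h ℤ.- tF f (suc h)           -- t(2h+1) = -t(h) - t(h+1)

t : ℕ → ℤ
t n = tF (suc n) n

-- Formal power series over ℤ: coefficient functions ℕ → ℤ.

sumBelow : ℕ → (ℕ → ℤ) → ℤ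
sumBelow zero f = + 0
sumBelow (suc n) f = sumBelow n f ℤ.+ f n

conv : (ℕ → ℤ) → (ℕ → ℤ) → ℕ → ℤ
conv f g n = sumBelow (suc n) (λ i → f i ℤ.* g (n ℕ.∸ i))

-- Multiplicative inverse of a power series f with f 0 = 1:
-- u 0 = 1,  u n = - Σ_{i=1}^{n} f i * u (n - i).
-- invList f n = [u n , u (n-1) , … , u 0].
invDot : (ℕ → ℤ) → ℕ → List ℤ → ℤ
invDot f j [] = + 0
invDot f j (x ∷ xs) = f (suc j) ℤ.* x ℤ.+ invDot f (suc j) xs

invList : (ℕ → ℤ) → ℕ → List ℤ
invList f zero = + 1 ∷ []
invList f (suc n) = let prev = invList f n in ℤ.- invDot f 0 prev ∷ prev

headZ : List ℤ → ℤ
headZ [] = + 0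
headZ (x ∷ _) = x

inv₁ : (ℕ → ℤ) → ℕ → ℤ
inv₁ f n = headZ (invList f n)

-- Formal Laurent series over ℤ (with finite principal part):
-- a Laurent series  z^(-ord) * Σ_{n≥0} coef n z^n.

record Laurent : Set where
  constructor laurent
  field
    ord  : ℕ
    coef : ℕ → ℤ
open Laurent public

coeffAt : Laurent → ℤ → ℤ
coeffAt (laurent k c) m with m ℤ.+ + k
... | + j = c j
... | -[1+ _ ] = + 0

infix 4 _≈L_
_≈L_ : Laurent → Laurent → Set
A ≈L B = ∀ (m : ℤ) → coeffAt A m ≡ coeffAt B m

ps : (ℕ → ℤ) → Laurent
ps c = laurent 0 c

infixl 7 _⊛_
_⊛_ : Laurent → Laurent → Laurent
laurent k c ⊛ laurent l d = laurent (k ℕ.+ l) (conv c d)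

negL : Laurent → Laurent
negL (laurent k c) = laurent k (λ n → ℤ.- c n)

-- substitution z ↦ z^d  (for d ≥ 1)
dilate : ℕ → (ℕ → ℤ) → ℕ → ℤ
dilate d c n with d ∣? n
... | yes p = c (_∣_.quotient p)
... | no _ = + 0

substPow : ℕ → Laurent → Laurent
substPow d (laurent k c) = laurent (k ℕ.* d) (dilate d c)

-- Since s(0) = 0 and s(1) = 1, S(z) = z·T(z) with
-- T(z) = Σ s(n+1) z^n having constant term 1, so for a power series A,
-- the Laurent series A(z)/S(z) is  z^(-1) · A(z) · T(z)^(-1).

S : Laurent
S = ps s

divByS : (ℕ → ℤ) → Laurent
divByS a = laurent 1 (conv a (inv₁ (λ n → s (suc n))))

G : Laurent
G = divByS (λ n → s (2 ℕ.+ n) ℤ.- s (1 ℕ.+ n))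

H : Laurent
H = negL (divByS (λ n → t (2 ℕ.+ n) ℤ.+ t (1 ℕ.+ n)))

module Submission where

-- Write  B  for Stern's doubling operator on coefficient
-- sequences,  (B g)(2m) = g m  and  (B g)(2m+1) = g m + g (m+1);  on series
-- this is  G(z) ↦ (z⁻¹ + 1 + z) G(z²)  when  g 0 = 0.  Stern's sequence is a
-- fixed point,  s = B s,  and the twisted sequence satisfies  B t = -t  away
-- from the first two indices.  Three facts about  B  drive the proof:
--   * Y(z²)·(B h)(z) = (B (Y·h))(z)        ("spread-conv"),
--   * B (zᵈ b) = z²ᵈ (B b)                  ("B-raise"),
--   * B commutes with translations  g ↦ g(c + ·)  up to doubling c.
-- For a sequence g with  B g m = κ · g m  (m ≥ 2) put
-- diff d n = κ g(2d+n) − g(d+n).  If  X(zᵈ)S(z) = zᵈ σ·diff d,  the three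
-- facts give  X(z²ᵈ)S(z) = z²ᵈ (κσ)·diff (2d); starting at d = 1, where
-- X(z)S(z) = z·A(z) because X = A/T with S = z·T, induction yields the claim
-- for every d = 2ᵉ.

open import Defs
open import Data.Nat using (ℕ; suc; _^_; _+_)
open import Data.Integer using (ℤ; +_; -_; _*_) renaming (_+_ to _+ℤ_; _-_ to _-ℤ_; _^_ to _^ℤ_)
open import Data.Product using (_×_)

open import Data.Nat using (zero; _∸_; _<_; _≤_; z≤n; s≤s; ⌊_/2⌋) renaming (_*_ to _*ℕ_)
import Data.Nat.Properties as ℕP
open import Data.Nat.Divisibility using (_∣_; _∣?_; divides)
open import Data.Integer using (-[1+_])
import Data.Integer.Properties as ℤP
open import Data.Integer.Solver using (module +-*-Solver)
open +-*-Solver using (solve; _:+_; _:-_; _:*_; :-_; _:=_; con)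
open import Data.Bool using (true; false)
open import Data.Product using (∃; _,_)
open import Data.Sum using (_⊎_; inj₁; inj₂)
open import Data.Empty using (⊥; ⊥-elim)
open import Relation.Nullary using (¬_; yes; no)
open import Relation.Binary.PropositionalEquality
  using (_≡_; _≗_; refl; sym; trans; cong; cong₂; subst; module ≡-Reasoning)

sum-first : ∀ n (h : ℕ → ℤ) → sumBelow (suc n) h ≡ h 0 +ℤ sumBelow n (λ i → h (suc i))
sum-first zero h = ℤP.+-comm (+ 0) (h 0)
sum-first (suc n) h rewrite sum-first n h = ℤP.+-assoc (h 0) _ _

sum-cong : ∀ n {h h' : ℕ → ℤ} → (∀ i → i < n → h i ≡ h' i) → sumBelow n h ≡ sumBelow n h'
sum-cong zero eq = refl
sum-cong (suc n) eq = cong₂ _+ℤ_ (sum-cong n (λ i i<n → eq i (ℕP.m<n⇒m<1+n i<n))) (eq n ℕP.≤-refl)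

sum-add : ∀ n (h h' : ℕ → ℤ) → sumBelow n (λ i → h i +ℤ h' i) ≡ sumBelow n h +ℤ sumBelow n h'
sum-add zero h h' = refl
sum-add (suc n) h h' rewrite sum-add n h h' =
  solve 4 (λ a b c d → (a :+ b) :+ (c :+ d) := (a :+ c) :+ (b :+ d)) refl
    (sumBelow n h) (sumBelow n h') (h n) (h' n)

sum-scale : ∀ n c (h : ℕ → ℤ) → sumBelow n (λ i → c * h i) ≡ c * sumBelow n h
sum-scale zero c h = sym (ℤP.*-zeroʳ c)
sum-scale (suc n) c h rewrite sum-scale n c h = sym (ℤP.*-distribˡ-+ c (sumBelow n h) (h n))

sum-rev : ∀ n (h : ℕ → ℤ) → sumBelow (suc n) h ≡ sumBelow (suc n) (λ i → h (n ∸ i))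
sum-rev zero h = refl
sum-rev (suc n) h = trans (cong (_+ℤ h (suc n)) (sum-rev n h))
  (trans (ℤP.+-comm _ (h (suc n))) (sym (sum-first (suc n) (λ i → h (suc n ∸ i)))))

conv-suc : ∀ f g n → conv f g (suc n) ≡ f 0 * g (suc n) +ℤ conv (λ i → f (suc i)) g n
conv-suc f g n = sum-first (suc n) (λ i → f i * g (suc n ∸ i))

conv-zero : ∀ f g → conv f g 0 ≡ f 0 * g 0
conv-zero f g = ℤP.+-identityˡ _

conv-cong : ∀ {f f' g g'} → f ≗ f' → g ≗ g' → conv f g ≗ conv f' g'
conv-cong ef eg n = sum-cong (suc n) (λ i _ → cong₂ _*_ (ef i) (eg (n ∸ i)))

conv-congˡ : ∀ {f f'} g → f ≗ f' → conv f g ≗ conv f' g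
conv-congˡ g ef = conv-cong {g = g} {g' = g} ef (λ _ → refl)

conv-comm : ∀ f g → conv f g ≗ conv g f
conv-comm f g n = trans (sum-rev n (λ i → f i * g (n ∸ i)))
  (sum-cong (suc n) λ i i≤n →
    trans (cong (λ j → f (n ∸ i) * g j) (ℕP.m∸[m∸n]≡n (ℕP.≤-pred i≤n))) (ℤP.*-comm (f (n ∸ i)) (g i)))

conv-addˡ : ∀ f f' g n → conv (λ i → f i +ℤ f' i) g n ≡ conv f g n +ℤ conv f' g n
conv-addˡ f f' g n =
  trans (sum-cong (suc n) (λ i _ → ℤP.*-distribʳ-+ (g (n ∸ i)) (f i) (f' i)))
        (sum-add (suc n) (λ i → f i * g (n ∸ i)) (λ i → f' i * g (n ∸ i)))

conv-scaleˡ : ∀ c f g n → conv (λ i → c * f i) g n ≡ c * conv f g n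
conv-scaleˡ c f g n =
  trans (sum-cong (suc n) (λ i _ → ℤP.*-assoc c (f i) (g (n ∸ i))))
        (sum-scale (suc n) c (λ i → f i * g (n ∸ i)))

conv-negˡ : ∀ f g n → conv (λ i → - f i) g n ≡ - conv f g n
conv-negˡ f g n = begin
  conv (λ i → - f i) g n         ≡⟨ conv-congˡ g (λ i → sym (ℤP.-1*i≡-i (f i))) n ⟩
  conv (λ i → - + 1 * f i) g n   ≡⟨ conv-scaleˡ (- + 1) f g n ⟩
  - + 1 * conv f g n             ≡⟨ ℤP.-1*i≡-i _ ⟩
  - conv f g n                   ∎
  where open ≡-Reasoning

conv-assoc : ∀ n f g h → conv (conv f g) h n ≡ conv f (conv g h) n
conv-assoc zero f g h = begin
  conv (conv f g) h 0      ≡⟨ conv-zero (conv f g) h ⟩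
  conv f g 0 * h 0         ≡⟨ cong (_* h 0) (conv-zero f g) ⟩
  f 0 * g 0 * h 0          ≡⟨ ℤP.*-assoc (f 0) (g 0) (h 0) ⟩
  f 0 * (g 0 * h 0)        ≡⟨ cong (f 0 *_) (sym (conv-zero g h)) ⟩
  f 0 * conv g h 0         ≡⟨ sym (conv-zero f (conv g h)) ⟩
  conv f (conv g h) 0      ∎
  where open ≡-Reasoning
conv-assoc (suc n) f g h = begin
  conv (conv f g) h (suc n)
    ≡⟨ conv-suc (conv f g) h n ⟩
  conv f g 0 * h (suc n) +ℤ conv (λ i → conv f g (suc i)) h n
    ≡⟨ cong₂ _+ℤ_ (cong (_* h (suc n)) (conv-zero f g)) (conv-congˡ h (conv-suc f g) n) ⟩
  f 0 * g 0 * h (suc n) +ℤ conv (λ i → f 0 * g (suc i) +ℤ conv f' g i) h n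
    ≡⟨ cong (f 0 * g 0 * h (suc n) +ℤ_) (trans (conv-addˡ (λ i → f 0 * g' i) (conv f' g) h n)
         (cong₂ _+ℤ_ (conv-scaleˡ (f 0) (λ i → g (suc i)) h n) (conv-assoc n f' g h))) ⟩
  f 0 * g 0 * h (suc n) +ℤ (f 0 * conv g' h n +ℤ conv f' (conv g h) n)
    ≡⟨ regroup (f 0) (g 0) (h (suc n)) (conv g' h n) (conv f' (conv g h) n) ⟩
  f 0 * (g 0 * h (suc n) +ℤ conv g' h n) +ℤ conv f' (conv g h) n
    ≡⟨ cong (λ x → f 0 * x +ℤ conv f' (conv g h) n) (sym (conv-suc g h n)) ⟩
  f 0 * conv g h (suc n) +ℤ conv f' (conv g h) n
    ≡⟨ sym (conv-suc f (conv g h) n) ⟩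
  conv f (conv g h) (suc n) ∎
  where
  open ≡-Reasoning
  f' g' : ℕ → ℤ
  f' i = f (suc i)
  g' i = g (suc i)
  regroup : ∀ a b c x y → a * b * c +ℤ (a * x +ℤ y) ≡ a * (b * c +ℤ x) +ℤ y
  regroup = solve 5 (λ a b c x y → a :* b :* c :+ (a :* x :+ y) := a :* (b :* c :+ x) :+ y) refl

δ : ℕ → ℤ
δ zero = + 1
δ (suc _) = + 0

conv-δʳ : ∀ f → conv f δ ≗ f
conv-δʳ f zero = trans (conv-zero f δ) (ℤP.*-identityʳ (f 0))
conv-δʳ f (suc n) = begin
  conv f δ (suc n)                                  ≡⟨ conv-comm f δ (suc n) ⟩
  conv δ f (suc n)                                  ≡⟨ conv-suc δ f n ⟩
  + 1 * f (suc n) +ℤ conv (λ _ → + 0) f n           ≡⟨ cong (+ 1 * f (suc n) +ℤ_) (sum-zeros (suc n)) ⟩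
  + 1 * f (suc n) +ℤ + 0                            ≡⟨ ℤP.+-identityʳ _ ⟩
  + 1 * f (suc n)                                   ≡⟨ ℤP.*-identityˡ _ ⟩
  f (suc n)                                         ∎
  where
  open ≡-Reasoning
  sum-zeros : ∀ m → sumBelow m (λ i → + 0 * f (n ∸ i)) ≡ + 0
  sum-zeros zero = refl
  sum-zeros (suc m) rewrite sum-zeros m = refl

conv-shiftʳ : ∀ f g → g 0 ≡ + 0 → ∀ n → conv f g (suc n) ≡ conv f (λ i → g (suc i)) n
conv-shiftʳ f g g0 n = begin
  conv f g (suc n)                          ≡⟨ conv-comm f g (suc n) ⟩
  conv g f (suc n)                          ≡⟨ conv-suc g f n ⟩
  g 0 * f (suc n) +ℤ conv g' f n            ≡⟨ cong (λ x → x * f (suc n) +ℤ conv g' f n) g0 ⟩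
  + 0 +ℤ conv g' f n                        ≡⟨ ℤP.+-identityˡ _ ⟩
  conv g' f n                               ≡⟨ conv-comm g' f n ⟩
  conv f g' n                               ∎
  where
  open ≡-Reasoning
  g' : ℕ → ℤ
  g' i = g (suc i)

invDot-sum : ∀ f n k →
  invDot f k (invList f n) ≡ sumBelow (suc n) (λ i → f (suc (k + i)) * inv₁ f (n ∸ i))
invDot-sum f zero k rewrite ℕP.+-identityʳ k =
  trans (ℤP.+-identityʳ (f (suc k) * + 1)) (sym (ℤP.+-identityˡ (f (suc k) * + 1)))
invDot-sum f (suc n) k = begin
  f (suc k) * inv₁ f (suc n) +ℤ invDot f (suc k) (invList f n)
    ≡⟨ cong (f (suc k) * inv₁ f (suc n) +ℤ_) (invDot-sum f n (suc k)) ⟩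
  f (suc k) * inv₁ f (suc n) +ℤ sumBelow (suc n) (λ i → f (suc (suc k + i)) * inv₁ f (n ∸ i))
    ≡⟨ sym (cong₂ _+ℤ_ (cong (λ j → f (suc j) * inv₁ f (suc n)) (ℕP.+-identityʳ k))
                       (sum-cong (suc n) (λ i _ → cong (λ j → f (suc j) * inv₁ f (n ∸ i)) (ℕP.+-suc k i)))) ⟩
  f (suc (k + 0)) * inv₁ f (suc n) +ℤ sumBelow (suc n) (λ i → f (suc (k + suc i)) * inv₁ f (n ∸ i))
    ≡⟨ sym (sum-first (suc n) (λ i → f (suc (k + i)) * inv₁ f (suc n ∸ i))) ⟩
  sumBelow (suc (suc n)) (λ i → f (suc (k + i)) * inv₁ f (suc n ∸ i)) ∎
  where open ≡-Reasoning

inv-right : ∀ f → f 0 ≡ + 1 → conv f (inv₁ f) ≗ δ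
inv-right f f0 zero = trans (conv-zero f (inv₁ f)) (cong (_* + 1) f0)
inv-right f f0 (suc n) = begin
  conv f (inv₁ f) (suc n)                 ≡⟨ conv-suc f (inv₁ f) n ⟩
  f 0 * (- x) +ℤ conv f' (inv₁ f) n       ≡⟨ cong₂ (λ a b → a * (- x) +ℤ b) f0 (sym (invDot-sum f n 0)) ⟩
  + 1 * (- x) +ℤ x                        ≡⟨ cong (_+ℤ x) (ℤP.*-identityˡ (- x)) ⟩
  - x +ℤ x                                ≡⟨ ℤP.+-inverseˡ x ⟩
  + 0                                     ∎
  where
  open ≡-Reasoning
  x : ℤ
  x = invDot f 0 (invList f n)
  f' : ℕ → ℤ
  f' i = f (suc i)

-- raise k b  is the sequence of  zᵏ·b(z).
raise : ℕ → (ℕ → ℤ) → ℕ → ℤ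
raise zero b n = b n
raise (suc k) b zero = + 0
raise (suc k) b (suc n) = raise k b n

-- spread Y  is the sequence of  Y(z²).
spread : (ℕ → ℤ) → ℕ → ℤ
spread Y zero = Y 0
spread Y (suc zero) = + 0
spread Y (suc (suc n)) = spread (λ i → Y (suc i)) n

B : (ℕ → ℤ) → ℕ → ℤ
B g zero = g 0
B g (suc zero) = g 0 +ℤ g 1
B g (suc (suc n)) = B (λ i → g (suc i)) n

raise-cong : ∀ k {b b'} → b ≗ b' → raise k b ≗ raise k b'
raise-cong zero eq n = eq n
raise-cong (suc k) eq zero = refl
raise-cong (suc k) eq (suc n) = raise-cong k eq n

raise-at : ∀ k b j → raise k b (k + j) ≡ b j
raise-at zero b j = refl
raise-at (suc k) b j = raise-at k b j

raise-below : ∀ k b i → i < k → raise k b i ≡ + 0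
raise-below (suc k) b zero _ = refl
raise-below (suc k) b (suc i) (s≤s i<k) = raise-below k b i i<k

raise-at-zero : ∀ k b → b 0 ≡ + 0 → raise k b 0 ≡ + 0
raise-at-zero zero b b0 = b0
raise-at-zero (suc k) b b0 = refl

spread-even : ∀ Y k → spread Y (k + k) ≡ Y k
spread-even Y zero = refl
spread-even Y (suc k) rewrite ℕP.+-suc k k = spread-even (λ i → Y (suc i)) k

spread-odd : ∀ Y k → spread Y (suc (k + k)) ≡ + 0
spread-odd Y zero = refl
spread-odd Y (suc k) rewrite ℕP.+-suc k k = spread-odd (λ i → Y (suc i)) k

B-even : ∀ g k → B g (k + k) ≡ g k
B-even g zero = refl
B-even g (suc k) rewrite ℕP.+-suc k k = B-even (λ i → g (suc i)) k

B-odd : ∀ g k → B g (suc (k + k)) ≡ g k +ℤ g (suc k)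
B-odd g zero = refl
B-odd g (suc k) rewrite ℕP.+-suc k k = B-odd (λ i → g (suc i)) k

B-cong : ∀ {g g'} → g ≗ g' → B g ≗ B g'
B-cong eq zero = eq 0
B-cong eq (suc zero) = cong₂ _+ℤ_ (eq 0) (eq 1)
B-cong eq (suc (suc n)) = B-cong (λ i → eq (suc i)) n

B-pointwise : (φ : ℤ → ℤ → ℤ) → (∀ x x' y y' → φ (x +ℤ x') (y +ℤ y') ≡ φ x y +ℤ φ x' y') →
              ∀ f h → B (λ i → φ (f i) (h i)) ≗ (λ n → φ (B f n) (B h n))
B-pointwise φ additive f h zero = refl
B-pointwise φ additive f h (suc zero) = sym (additive (f 0) (f 1) (h 0) (h 1))
B-pointwise φ additive f h (suc (suc n)) =
  B-pointwise φ additive (λ i → f (suc i)) (λ i → h (suc i)) n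

B-translate : ∀ g c n → B (λ i → g (c + i)) n ≡ B g (c + c + n)
B-translate g zero n = refl
B-translate g (suc c) n rewrite ℕP.+-suc c c = B-translate (λ i → g (suc i)) c n

B-raise : ∀ d b → b 0 ≡ + 0 → B (raise d b) ≗ raise (d + d) (B b)
B-raise zero b b0 n = refl
B-raise (suc d) b b0 zero = refl
B-raise (suc d) b b0 (suc zero) rewrite raise-at-zero d b b0 | ℕP.+-suc d d = refl
B-raise (suc d) b b0 (suc (suc n)) rewrite ℕP.+-suc d d = B-raise d b b0 n

spread-conv : ∀ h → h 0 ≡ + 0 → ∀ n Y → conv (spread Y) (B h) n ≡ B (conv Y h) n
spread-conv h h0 zero Y = refl
spread-conv h h0 (suc zero) Y rewrite h0 =
  solve 3 (λ y₀ y₁ h₁ → (con (+ 0) :+ y₀ :* (con (+ 0) :+ h₁)) :+ con (+ 0) :* con (+ 0)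
                      := (con (+ 0) :+ y₀ :* con (+ 0)) :+ ((con (+ 0) :+ y₀ :* h₁) :+ y₁ :* con (+ 0)))
    refl (Y 0) (Y 1) (h 1)
spread-conv h h0 (suc (suc n)) Y = begin
  conv (spread Y) (B h) (suc (suc n))
    ≡⟨ conv-suc (spread Y) (B h) (suc n) ⟩
  Y 0 * B h (suc (suc n)) +ℤ conv (λ i → spread Y (suc i)) (B h) (suc n)
    ≡⟨ cong (Y 0 * B h (suc (suc n)) +ℤ_) (conv-suc (λ i → spread Y (suc i)) (B h) n) ⟩
  Y 0 * B h' n +ℤ (+ 0 * B h (suc n) +ℤ conv (spread Y') (B h) n)
    ≡⟨ cong (λ x → Y 0 * B h' n +ℤ (+ 0 +ℤ x)) (spread-conv h h0 n Y') ⟩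
  Y 0 * B h' n +ℤ (+ 0 +ℤ B (conv Y' h) n)
    ≡⟨ cong (Y 0 * B h' n +ℤ_) (ℤP.+-identityˡ _) ⟩
  Y 0 * B h' n +ℤ B (conv Y' h) n
    ≡⟨ sym (B-pointwise (λ x y → Y 0 * x +ℤ y) additive h' (conv Y' h) n) ⟩
  B (λ i → Y 0 * h' i +ℤ conv Y' h i) n
    ≡⟨ sym (B-cong (conv-suc Y h) n) ⟩
  B (conv Y h) (suc (suc n)) ∎
  where
  open ≡-Reasoning
  Y' h' : ℕ → ℤ
  Y' i = Y (suc i)
  h' i = h (suc i)
  additive : ∀ x x' y y' → Y 0 * (x +ℤ x') +ℤ (y +ℤ y') ≡ (Y 0 * x +ℤ y) +ℤ (Y 0 * x' +ℤ y')
  additive = solve 5 (λ a x x' y y' → a :* (x :+ x') :+ (y :+ y') := (a :* x :+ y) :+ (a :* x' :+ y'))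
               refl (Y 0)


parity : ∀ n → ∃ λ k → n ≡ k + k ⊎ n ≡ suc (k + k)
parity zero = 0 , inj₁ refl
parity (suc n) with parity n
... | k , inj₁ n≡2k = k , inj₂ (cong suc n≡2k)
... | k , inj₂ n≡2k+1 = suc k , inj₁ (trans (cong suc n≡2k+1) (cong suc (sym (ℕP.+-suc k k))))

isEven-double : ∀ k → isEven (k + k) ≡ true
isEven-double zero = refl
isEven-double (suc k) rewrite ℕP.+-suc k k = isEven-double k

isEven-odd : ∀ k → isEven (suc (k + k)) ≡ false
isEven-odd zero = refl
isEven-odd (suc k) rewrite ℕP.+-suc k k = isEven-odd k

odd≢double : ∀ m k → suc (m + m) ≡ k + k → ⊥
odd≢double m k eq with trans (sym (isEven-odd m)) (trans (cong isEven eq) (isEven-double k))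
... | ()

half-odd : ∀ k → ⌊ suc (k + k) /2⌋ ≡ k
half-odd zero = refl
half-odd (suc k) rewrite ℕP.+-suc k k = cong suc (half-odd k)

double-injective : ∀ a b → a + a ≡ b + b → a ≡ b
double-injective a b eq = trans (ℕP.n≡⌊n+n/2⌋ a) (trans (cong ⌊_/2⌋ eq) (sym (ℕP.n≡⌊n+n/2⌋ b)))

dilate-multiple : ∀ d c q → dilate (suc d) c (q *ℕ suc d) ≡ c q
dilate-multiple d c q with suc d ∣? q *ℕ suc d
... | yes (divides q' eq) = cong c (sym (ℕP.*-cancelʳ-≡ q q' (suc d) eq))
... | no ∤ = ⊥-elim (∤ (divides q refl))

dilate-non-multiple : ∀ d c n → ¬ (d ∣ n) → dilate d c n ≡ + 0
dilate-non-multiple d c n ∤ with d ∣? n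
... | yes ∣ = ⊥-elim (∤ ∣)
... | no _ = refl

dilate-one : ∀ c → dilate 1 c ≗ c
dilate-one c n = trans (cong (dilate 1 c) (sym (ℕP.*-identityʳ n))) (dilate-multiple 0 c n)

dilate-even : ∀ d c m → dilate (suc d + suc d) c (m + m) ≡ dilate (suc d) c m
dilate-even d c m with suc d ∣? m
... | yes (divides q m≡qD) = trans (cong (dilate (suc d + suc d) c)
        (trans (cong₂ _+_ m≡qD m≡qD) (sym (ℕP.*-distribˡ-+ q (suc d) (suc d)))))
        (dilate-multiple (d + suc d) c q)
... | no ∤ = dilate-non-multiple (suc d + suc d) c (m + m) λ where
        (divides q eq) → ∤ (divides q (double-injective m (q *ℕ suc d)
            (trans eq (ℕP.*-distribˡ-+ q (suc d) (suc d)))))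

dilate-odd : ∀ d c m → dilate (d + d) c (suc (m + m)) ≡ + 0
dilate-odd d c m = dilate-non-multiple (d + d) c (suc (m + m)) λ where
  (divides q eq) → odd≢double m (q *ℕ d) (trans eq (ℕP.*-distribˡ-+ q d d))

dilate-double : ∀ d c → dilate (suc d + suc d) c ≗ spread (dilate (suc d) c)
dilate-double d c n with parity n
... | k , inj₁ refl = trans (dilate-even d c k) (sym (spread-even (dilate (suc d) c) k))
... | k , inj₂ refl = trans (dilate-odd (suc d) c k) (sym (spread-odd (dilate (suc d) c) k))

private
  even-fuel : ∀ n f → suc (suc (suc n)) ≤ suc f → suc ⌊ n /2⌋ < f
  even-fuel n f (s≤s le) = ℕP.≤-trans (s≤s (s≤s (ℕP.⌊n/2⌋≤n n))) le

  odd-fuel : ∀ n f → isEven n ≡ false → suc (suc (suc n)) ≤ suc f → suc (suc ⌊ n /2⌋) < f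
  odd-fuel zero f () le
  odd-fuel (suc n) f _ (s≤s le) = ℕP.≤-trans (s≤s (s≤s (ℕP.⌊n/2⌋<n n))) le

sF-fuel : ∀ f f' n → n < f → n < f' → sF f n ≡ sF f' n
sF-fuel (suc f) (suc f') zero _ _ = refl
sF-fuel (suc f) (suc f') (suc zero) _ _ = refl
sF-fuel (suc f) (suc f') (suc (suc n)) lt lt' with isEven n in parity-n
... | true = sF-fuel f f' _ (even-fuel n f lt) (even-fuel n f' lt')
... | false = cong₂ _+ℤ_ (sF-fuel f f' _ (even-fuel n f lt) (even-fuel n f' lt'))
                         (sF-fuel f f' _ (odd-fuel n f parity-n lt) (odd-fuel n f' parity-n lt'))

tF-fuel : ∀ f f' n → n < f → n < f' → tF f n ≡ tF f' n
tF-fuel (suc f) (suc f') zero _ _ = refl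
tF-fuel (suc f) (suc f') (suc zero) _ _ = refl
tF-fuel (suc f) (suc f') (suc (suc n)) lt lt' with isEven n in parity-n
... | true = cong -_ (tF-fuel f f' _ (even-fuel n f lt) (even-fuel n f' lt'))
... | false = cong₂ _-ℤ_ (cong -_ (tF-fuel f f' _ (even-fuel n f lt) (even-fuel n f' lt')))
                         (tF-fuel f f' _ (odd-fuel n f parity-n lt) (odd-fuel n f' parity-n lt'))

s-even : ∀ m → s (m + m) ≡ s m
s-even zero = refl
s-even (suc k) rewrite ℕP.+-suc k k | isEven-double k | sym (ℕP.n≡⌊n+n/2⌋ k) =
  sF-fuel _ _ (suc k) (s≤s (s≤s (ℕP.m≤m+n k k))) ℕP.≤-refl

s-odd : ∀ m → s (suc (m + m)) ≡ s m +ℤ s (suc m)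
s-odd zero = refl
s-odd (suc k) rewrite ℕP.+-suc k k | isEven-odd k | half-odd k =
  cong₂ _+ℤ_ (sF-fuel _ _ (suc k) (s≤s (s≤s (ℕP.m≤n⇒m≤1+n (ℕP.m≤m+n k k)))) ℕP.≤-refl)
             (sF-fuel _ _ (suc (suc k)) (s≤s (s≤s (s≤s (ℕP.m≤m+n k k)))) ℕP.≤-refl)

t-even : ∀ m → t (m + m) ≡ - t m
t-even zero = refl
t-even (suc k) rewrite ℕP.+-suc k k | isEven-double k | sym (ℕP.n≡⌊n+n/2⌋ k) =
  cong -_ (tF-fuel _ _ (suc k) (s≤s (s≤s (ℕP.m≤m+n k k))) ℕP.≤-refl)

t-odd : ∀ k → t (suc (suc k + suc k)) ≡ - t (suc k) -ℤ t (suc (suc k))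
t-odd k rewrite ℕP.+-suc k k | isEven-odd k | half-odd k =
  cong₂ _-ℤ_ (cong -_ (tF-fuel _ _ (suc k) (s≤s (s≤s (ℕP.m≤n⇒m≤1+n (ℕP.m≤m+n k k)))) ℕP.≤-refl))
             (tF-fuel _ _ (suc (suc k)) (s≤s (s≤s (s≤s (ℕP.m≤m+n k k)))) ℕP.≤-refl)

B-s : ∀ m → B s m ≡ s m
B-s m with parity m
... | k , inj₁ refl = trans (B-even s k) (sym (s-even k))
... | k , inj₂ refl = trans (B-odd s k) (sym (s-odd k))

B-t : ∀ m → 2 ≤ m → B t m ≡ - + 1 * t m
B-t m 2≤m with parity m
B-t m () | zero , inj₁ refl
B-t m (s≤s ()) | zero , inj₂ refl
... | suc k , inj₁ refl = begin
  B t (suc k + suc k)      ≡⟨ B-even t (suc k) ⟩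
  t (suc k)                ≡⟨ sym (ℤP.neg-involutive _) ⟩
  - - t (suc k)            ≡⟨ cong -_ (sym (t-even (suc k))) ⟩
  - t (suc k + suc k)      ≡⟨ sym (ℤP.-1*i≡-i _) ⟩
  - + 1 * t (suc k + suc k) ∎
  where open ≡-Reasoning
... | suc k , inj₂ refl = begin
  B t (suc (suc k + suc k))          ≡⟨ B-odd t (suc k) ⟩
  t (suc k) +ℤ t (suc (suc k))       ≡⟨ negate (t (suc k)) (t (suc (suc k))) ⟩
  - + 1 * (- t (suc k) -ℤ t (suc (suc k)))
                                     ≡⟨ cong (- + 1 *_) (sym (t-odd k)) ⟩
  - + 1 * t (suc (suc k + suc k))    ∎
  where
  open ≡-Reasoning
  negate : ∀ a b → a +ℤ b ≡ - + 1 * (- a -ℤ b)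
  negate = solve 2 (λ a b → a :+ b := (:- con (+ 1)) :* ((:- a) :- b)) refl

-- The starting point  d = 1:  S(z) = z·T(z)  with  T(0) = 1,  so for
-- X = A/T  one has  X(z)·S(z) = z·A(z).

T : ℕ → ℤ
T n = s (suc n)

u : ℕ → ℤ
u = inv₁ T

divided-times-S : ∀ a → conv (conv a u) s ≗ raise 1 a
divided-times-S a zero = trans (conv-zero (conv a u) s) (ℤP.*-zeroʳ (conv a u 0))
divided-times-S a (suc j) = begin
  conv (conv a u) s (suc j)   ≡⟨ conv-shiftʳ (conv a u) s refl j ⟩
  conv (conv a u) T j         ≡⟨ conv-assoc j a u T ⟩
  conv a (conv u T) j         ≡⟨ conv-cong {f = a} (λ _ → refl) u*T≗δ j ⟩
  conv a δ j                  ≡⟨ conv-δʳ a j ⟩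
  a j                         ∎
  where
  open ≡-Reasoning
  u*T≗δ : conv u T ≗ δ
  u*T≗δ i = trans (conv-comm u T i) (inv-right T refl i)

-- 2ᵉ⁺¹ = 2ᵉ + 2ᵉ, the form in which the doubling step produces it.
double-power : ∀ e → 2 ^ suc e ≡ 2 ^ e + 2 ^ e
double-power e = cong (λ k → 2 ^ e + k) (ℕP.+-identityʳ (2 ^ e))

2≤double+ : ∀ d x → 1 ≤ d → 2 ≤ d + d + x
2≤double+ d x 1≤d = ℕP.≤-trans (ℕP.+-mono-≤ 1≤d 1≤d) (ℕP.m≤m+n (d + d) x)

module Doubling (g : ℕ → ℤ) (κ : ℤ) (B-g : ∀ m → 2 ≤ m → B g m ≡ κ * g m) where

  diff : ℕ → ℕ → ℤ
  diff d n = κ * g (d + d + n) -ℤ g (d + n)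

  Claim : ℕ → ℤ → (ℕ → ℤ) → Set
  Claim d σ X = conv (dilate d X) s ≗ raise d (λ n → σ * diff d n)

  -- The constant term of  diff d  vanishes:  κ g(2d) = B g (2d) = g d.
  diff-zero : ∀ d → 1 ≤ d → diff d 0 ≡ + 0
  diff-zero d 1≤d rewrite ℕP.+-identityʳ (d + d) | ℕP.+-identityʳ d = begin
    κ * g (d + d) -ℤ g d   ≡⟨ cong (_-ℤ g d) (sym (B-g (d + d) (ℕP.+-mono-≤ 1≤d 1≤d))) ⟩
    B g (d + d) -ℤ g d     ≡⟨ cong (_-ℤ g d) (B-even g d) ⟩
    g d -ℤ g d             ≡⟨ ℤP.+-inverseʳ (g d) ⟩
    + 0                    ∎
    where open ≡-Reasoning

  B-diff : ∀ d σ → 1 ≤ d → B (λ n → σ * diff d n) ≗ (λ n → (κ * σ) * diff (d + d) n)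
  B-diff d σ 1≤d n = begin
    B (λ i → σ * (κ * g (d + d + i) -ℤ g (d + i))) n
      ≡⟨ B-pointwise (λ x y → σ * (κ * x -ℤ y)) additive (λ i → g (d + d + i)) (λ i → g (d + i)) n ⟩
    σ * (κ * B (λ i → g (d + d + i)) n -ℤ B (λ i → g (d + i)) n)
      ≡⟨ cong₂ (λ x y → σ * (κ * x -ℤ y)) (B-translate g (d + d) n) (B-translate g d n) ⟩
    σ * (κ * B g (d + d + (d + d) + n) -ℤ B g (d + d + n))
      ≡⟨ cong₂ (λ x y → σ * (κ * x -ℤ y))
           (B-g _ (2≤double+ (d + d) n (ℕP.≤-trans 1≤d (ℕP.m≤m+n d d)))) (B-g _ (2≤double+ d n 1≤d)) ⟩
    σ * (κ * (κ * g (d + d + (d + d) + n)) -ℤ κ * g (d + d + n))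
      ≡⟨ factor σ κ (g (d + d + (d + d) + n)) (g (d + d + n)) ⟩
    κ * σ * (κ * g (d + d + (d + d) + n) -ℤ g (d + d + n)) ∎
    where
    open ≡-Reasoning
    additive : ∀ x x' y y' → σ * (κ * (x +ℤ x') -ℤ (y +ℤ y')) ≡ σ * (κ * x -ℤ y) +ℤ σ * (κ * x' -ℤ y')
    additive = solve 6 (λ σ κ x x' y y' → σ :* (κ :* (x :+ x') :- (y :+ y'))
                                      := σ :* (κ :* x :- y) :+ σ :* (κ :* x' :- y')) refl σ κ
    factor : ∀ σ κ a b → σ * (κ * (κ * a) -ℤ κ * b) ≡ κ * σ * (κ * a -ℤ b)
    factor = solve 4 (λ σ κ a b → σ :* (κ :* (κ :* a) :- κ :* b) := κ :* σ :* (κ :* a :- b)) refl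

  doubling : ∀ d σ X → 1 ≤ d → Claim d σ X → Claim (d + d) (κ * σ) X
  doubling (suc d) σ X 1≤D claim n = begin
    conv (dilate (D + D) X) s n          ≡⟨ conv-cong (dilate-double d X) (λ i → sym (B-s i)) n ⟩
    conv (spread (dilate D X)) (B s) n   ≡⟨ spread-conv s refl n (dilate D X) ⟩
    B (conv (dilate D X) s) n            ≡⟨ B-cong claim n ⟩
    B (raise D σdiff) n                  ≡⟨ B-raise D σdiff σdiff-zero n ⟩
    raise (D + D) (B σdiff) n            ≡⟨ raise-cong (D + D) (B-diff D σ 1≤D) n ⟩
    raise (D + D) (λ i → κ * σ * diff (D + D) i) n ∎
    where
    open ≡-Reasoning
    D : ℕ
    D = suc d
    σdiff : ℕ → ℤ
    σdiff i = σ * diff D i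
    σdiff-zero : σdiff 0 ≡ + 0
    σdiff-zero = trans (cong (σ *_) (diff-zero D 1≤D)) (ℤP.*-zeroʳ σ)

  initial : ∀ X a → X ≗ conv a u → a ≗ diff 1 → Claim 1 (+ 1) X
  initial X a X≗a/T a≗diff n = begin
    conv (dilate 1 X) s n          ≡⟨ conv-congˡ s (λ i → trans (dilate-one X i) (X≗a/T i)) n ⟩
    conv (conv a u) s n            ≡⟨ divided-times-S a n ⟩
    raise 1 a n                    ≡⟨ raise-cong 1 (λ i → trans (a≗diff i) (sym (ℤP.*-identityˡ _))) n ⟩
    raise 1 (λ i → + 1 * diff 1 i) n ∎
    where open ≡-Reasoning

  powers : ∀ X → Claim 1 (+ 1) X → ∀ e → Claim (2 ^ e) (κ ^ℤ e) X
  powers X start zero = start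
  powers X start (suc e) = subst (λ d → Claim d (κ ^ℤ suc e) X) (sym (double-power e))
    (doubling (2 ^ e) (κ ^ℤ e) X (ℕP.m^n>0 2 e) (powers X start e))

negative-index-bound : ∀ j k i → -[1+ j ] +ℤ + k ≡ + i → i < k
negative-index-bound j k i eq = subst (i <_) (ℤP.+-injective i+j+1≡k) (ℕP.m<m+n i (s≤s z≤n))
  where
  i+j+1≡k : + (i + suc j) ≡ + k
  i+j+1≡k = trans (cong (_+ℤ + suc j) (sym eq))
              (solve 2 (λ x y → ((:- x) :+ y) :+ x := y) refl (+ suc j) (+ k))

coeff-negative : ∀ k F j → (∀ i → i < k → F i ≡ + 0) → coeffAt (laurent k F) -[1+ j ] ≡ + 0
coeff-negative k F j below with -[1+ j ] +ℤ + k in eq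
... | + i = below i (negative-index-bound j k i eq)
... | -[1+ _ ] = refl

-- The order is allowed to be any  k' ≡ k,  as it arises as  1·2ᵉ + 0.
raise-series : ∀ {k k'} F b → k' ≡ k → F ≗ raise k b → ps b ≈L laurent k' F
raise-series {k} F b refl F≗zᵏb (+ j) = begin
  b (j + 0)             ≡⟨ cong b (ℕP.+-identityʳ j) ⟩
  b j                   ≡⟨ sym (raise-at k b j) ⟩
  raise k b (k + j)     ≡⟨ cong (raise k b) (ℕP.+-comm k j) ⟩
  raise k b (j + k)     ≡⟨ sym (F≗zᵏb (j + k)) ⟩
  F (j + k)             ∎
  where open ≡-Reasoning
raise-series {k} F b refl F≗zᵏb -[1+ j ] =
  sym (coeff-negative k F j (λ i i<k → trans (F≗zᵏb i) (raise-below k b i i<k)))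

module SternDoubling = Doubling s (+ 1) (λ m _ → trans (B-s m) (sym (ℤP.*-identityˡ (s m))))
module TwistedDoubling = Doubling t (- + 1) B-t

stern-claim : ∀ e → conv (dilate (2 ^ e) (coef G)) s ≗
                    raise (2 ^ e) (λ n → s (2 ^ suc e + n) -ℤ s (2 ^ e + n))
stern-claim e n = trans (powers (coef G) (initial (coef G) _ (λ _ → refl) numerator≗diff) e n)
                        (raise-cong (2 ^ e) normalise n)
  where
  open SternDoubling
  numerator≗diff : (λ n → s (2 + n) -ℤ s (1 + n)) ≗ diff 1
  numerator≗diff n = cong (_-ℤ s (1 + n)) (sym (ℤP.*-identityˡ (s (2 + n))))
  normalise : ∀ n → (+ 1) ^ℤ e * diff (2 ^ e) n ≡ s (2 ^ suc e + n) -ℤ s (2 ^ e + n)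
  normalise n = begin
    (+ 1) ^ℤ e * diff (2 ^ e) n    ≡⟨ cong (_* diff (2 ^ e) n) (ℤP.^-zeroˡ e) ⟩
    + 1 * diff (2 ^ e) n         ≡⟨ ℤP.*-identityˡ _ ⟩
    + 1 * s (2 ^ e + 2 ^ e + n) -ℤ s (2 ^ e + n)
                                 ≡⟨ cong (_-ℤ s (2 ^ e + n)) (ℤP.*-identityˡ (s (2 ^ e + 2 ^ e + n))) ⟩
    s (2 ^ e + 2 ^ e + n) -ℤ s (2 ^ e + n)
                                 ≡⟨ cong (λ k → s (k + n) -ℤ s (2 ^ e + n)) (sym (double-power e)) ⟩
    s (2 ^ suc e + n) -ℤ s (2 ^ e + n) ∎
    where open ≡-Reasoning

twisted-claim : ∀ e → conv (dilate (2 ^ e) (coef H)) s ≗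
                      raise (2 ^ e) (λ n → ((- + 1) ^ℤ suc e) * (t (2 ^ suc e + n) +ℤ t (2 ^ e + n)))
twisted-claim e n = trans (powers (coef H) (initial (coef H) numerator H≗numerator/T numerator≗diff) e n)
                          (raise-cong (2 ^ e) normalise n)
  where
  open TwistedDoubling
  numerator : ℕ → ℤ
  numerator n = - (t (2 + n) +ℤ t (1 + n))
  H≗numerator/T : coef H ≗ conv numerator u
  H≗numerator/T n = sym (conv-negˡ (λ i → t (2 + i) +ℤ t (1 + i)) u n)
  numerator≗diff : numerator ≗ diff 1
  numerator≗diff n = solve 2 (λ a b → :- (a :+ b) := (:- con (+ 1)) :* a :- b) refl (t (2 + n)) (t (1 + n))
  normalise : ∀ n → (- + 1) ^ℤ e * diff (2 ^ e) n ≡ (- + 1) ^ℤ suc e * (t (2 ^ suc e + n) +ℤ t (2 ^ e + n))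
  normalise n = begin
    σ * (- + 1 * t (2 ^ e + 2 ^ e + n) -ℤ t (2 ^ e + n))
      ≡⟨ solve 3 (λ σ a b → σ :* ((:- con (+ 1)) :* a :- b) := ((:- con (+ 1)) :* σ) :* (a :+ b)) refl
           σ (t (2 ^ e + 2 ^ e + n)) (t (2 ^ e + n)) ⟩
    - + 1 * σ * (t (2 ^ e + 2 ^ e + n) +ℤ t (2 ^ e + n))
      ≡⟨ cong (λ k → - + 1 * σ * (t (k + n) +ℤ t (2 ^ e + n))) (sym (double-power e)) ⟩
    - + 1 * σ * (t (2 ^ suc e + n) +ℤ t (2 ^ e + n)) ∎
    where
    open ≡-Reasoning
    σ : ℤ
    σ = (- + 1) ^ℤ e

ord-power : ∀ e → 1 *ℕ 2 ^ e + 0 ≡ 2 ^ e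
ord-power e = trans (ℕP.+-identityʳ _) (ℕP.*-identityˡ _)

theorem1p2 :
    (∀ (e : ℕ) →
      ps (λ n → s (2 ^ suc e + n) -ℤ s (2 ^ e + n)) ≈L substPow (2 ^ e) G ⊛ S)
    ×
    (∀ (e : ℕ) →
      ps (λ n → ((- + 1) ^ℤ suc e) * (t (2 ^ suc e + n) +ℤ t (2 ^ e + n)))
        ≈L substPow (2 ^ e) H ⊛ S)
theorem1p2 =
  (λ e → raise-series _ _ (ord-power e) (stern-claim e)) ,
  (λ e → raise-series _ _ (ord-power e) (twisted-claim e))
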